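{- Let $L_n=C_n^b$ with $b(x)=(2x+1)^2$. For every prime $p\equiv 3\pmod 4$, the sequence $\{L_n\bmod p\}_{n\ge0}$ is purely periodic.
   Context: A Dyck path of semilength $n$ is a sequence of lattice points $(0,0)=(x_0,y_0),\dots,(x_{2n},y_{2n})=(2n,0)$ with all $y_i\ge0$ and each step equal to $(1,1)$ or $(1,-1)$. An up-step starting at height $y$ has weight $b(y)$, a down-step has weight $1$, and a path's weight is the product of its step weights. $C_n^b$ is the sum of the weights of all Dyck paths of semilength $n$. -}

module Defs where

open import Data.Nat using (ℕ; zero; suc; _+_; _*_; _∸_)
open import Data.Bool using (Bool; true; false; if_then_else_)
open import Data.List using (List; []; _∷_; map; concatMap)
open import Data.Nat.ListAction using (sum)

-- A step of a lattice path: U = (1,1), D = (1,-1).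
data Step : Set where
  U D : Step

allSeqs : ℕ → List (List Step)
allSeqs zero    = [] ∷ []
allSeqs (suc m) = concatMap (λ s → (U ∷ s) ∷ (D ∷ s) ∷ []) (allSeqs m)

validFrom : ℕ → List Step → Bool
validFrom zero    []       = true
validFrom (suc _) []       = false
validFrom y       (U ∷ s)  = validFrom (suc y) s
validFrom zero    (D ∷ s)  = false
validFrom (suc y) (D ∷ s)  = validFrom y s

weightFrom : (ℕ → ℕ) → ℕ → List Step → ℕ
weightFrom b y       []      = 1
weightFrom b y       (U ∷ s) = b y * weightFrom b (suc y) s
weightFrom b zero    (D ∷ s) = weightFrom b zero s   -- never reached for valid paths
weightFrom b (suc y) (D ∷ s) = weightFrom b y s

-- C^b_n : sum of weights of all Dyck paths of semilength n
-- (step sequences of length 2n from height 0, staying ≥ 0, ending at 0).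
C : (ℕ → ℕ) → ℕ → ℕ
C b n = sum (map (λ s → if validFrom 0 s then weightFrom b 0 s else 0)
                 (allSeqs (2 * n)))

bL : ℕ → ℕ
bL x = (2 * x + 1) * (2 * x + 1)

L : ℕ → ℕ
L n = C bL n

module Submission where

-- Transfer-matrix argument.  Let W m y be the total weight of the paths of
-- length m from height y down to 0, so that L_n = W (2n) 0.  Splitting a path
-- by its first step gives W (m+1) y = b y · W m (y+1) + W m (y-1): the profile
-- W (m+1) is obtained from W m by a tridiagonal "transfer" operator.  Write
-- p = 2h+1.  Since b h = p² ≡ 0, modulo p only the heights 0..h matter, and the
-- profiles live in the finite set (ℤ/p)^(h+1).  For y < h the weight b y is a
-- unit mod p, and h = 2t+1 is odd because p ≡ 3 (mod 4); then the transfer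
-- operator is injective mod p: the equations at heights 0,2,4,.. determine the
-- odd entries bottom-up, and those at heights h,h-2,.. the even entries
-- top-down.  An injective self-map of a finite set has purely periodic orbits,
-- so the profiles, and hence the values L_n mod p, are purely periodic.

open import Defs
open import Data.Nat
open import Data.Nat.Properties
open import Data.Nat.DivMod
open import Data.Nat.Divisibility
open import Data.Nat.Primality using (Prime; euclidsLemma)
open import Data.Nat.ListAction using (sum)
open import Data.Nat.Tactic.RingSolver using (solve-∀)
open import Data.Bool using (true; false; if_then_else_)
open import Data.List using (List; []; _∷_; map; concatMap)
open import Data.List.Properties using (map-cong)
open import Data.Fin using (Fin; toℕ; fromℕ<; finToFun; funToFin)
open import Data.Fin.Properties using (pigeonhole; toℕ-fromℕ<; finToFun-funToFin)
open import Data.Product using (Σ; ∃-syntax; _×_; _,_)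
open import Data.Sum using (_⊎_; inj₁; inj₂; [_,_]′; reduce)
open import Function using (_∘_; id)
open import Relation.Nullary using (¬_; contradiction)
open import Relation.Binary.PropositionalEquality
open ≡-Reasoning

pathWeight : (ℕ → ℕ) → ℕ → List Step → ℕ
pathWeight b y s = if validFrom y s then weightFrom b y s else 0

W : (ℕ → ℕ) → ℕ → ℕ → ℕ
W b m y = sum (map (pathWeight b y) (allSeqs m))

C≡W : ∀ b n → C b n ≡ W b (2 * n) 0
C≡W b n = refl

below : (ℕ → ℕ) → ℕ → ℕ
below v zero    = 0
below v (suc y) = v y

-- The transfer operator: a path from height y starts with an up-step of
-- weight b y, or with a down-step of weight 1.
transfer : (ℕ → ℕ) → (ℕ → ℕ) → ℕ → ℕ
transfer b v y = b y * v (suc y) + below v y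

sum-firstStep : (g : List Step → ℕ) (xs : List (List Step)) →
  sum (map g (concatMap (λ s → (U ∷ s) ∷ (D ∷ s) ∷ []) xs)) ≡
  sum (map (g ∘ (U ∷_)) xs) + sum (map (g ∘ (D ∷_)) xs)
sum-firstStep g []       = refl
sum-firstStep g (s ∷ xs) = begin
  g (U ∷ s) + (g (D ∷ s) + sum (map g (concatMap _ xs)))
    ≡⟨ cong (λ r → g (U ∷ s) + (g (D ∷ s) + r)) (sum-firstStep g xs) ⟩
  g (U ∷ s) + (g (D ∷ s) + (sum (map (g ∘ (U ∷_)) xs) + sum (map (g ∘ (D ∷_)) xs)))
    ≡⟨ interchange (g (U ∷ s)) (g (D ∷ s)) _ _ ⟩
  (g (U ∷ s) + sum (map (g ∘ (U ∷_)) xs)) + (g (D ∷ s) + sum (map (g ∘ (D ∷_)) xs)) ∎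
  where
  interchange : ∀ a b c d → a + (b + (c + d)) ≡ (a + c) + (b + d)
  interchange = solve-∀

sum-scale : {A : Set} (c : ℕ) (g : A → ℕ) (xs : List A) →
  sum (map (λ x → c * g x) xs) ≡ c * sum (map g xs)
sum-scale c g []       = sym (*-zeroʳ c)
sum-scale c g (x ∷ xs) =
  trans (cong (c * g x +_) (sum-scale c g xs)) (sym (*-distribˡ-+ c (g x) _))

sum-zeros : {A : Set} (xs : List A) → sum (map (λ _ → 0) xs) ≡ 0
sum-zeros []       = refl
sum-zeros (x ∷ xs) = sum-zeros xs

pathWeight-U : ∀ b y s → pathWeight b y (U ∷ s) ≡ b y * pathWeight b (suc y) s
pathWeight-U b zero s with validFrom 1 s
... | true  = refl
... | false = sym (*-zeroʳ (b 0))
pathWeight-U b (suc y) s with validFrom (suc (suc y)) s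
... | true  = refl
... | false = sym (*-zeroʳ (b (suc y)))

W-suc : ∀ b m y → W b (suc m) y ≡ transfer b (W b m) y
W-suc b m y = begin
  W b (suc m) y
    ≡⟨ sum-firstStep (pathWeight b y) xs ⟩
  sum (map (pathWeight b y ∘ (U ∷_)) xs) + sum (map (pathWeight b y ∘ (D ∷_)) xs)
    ≡⟨ cong₂ _+_ up-first (down-first y) ⟩
  b y * W b m (suc y) + below (W b m) y ∎
  where
  xs : List (List Step)
  xs = allSeqs m
  up-first : sum (map (pathWeight b y ∘ (U ∷_)) xs) ≡ b y * W b m (suc y)
  up-first = trans (cong sum (map-cong (pathWeight-U b y) xs))
                   (sum-scale (b y) (pathWeight b (suc y)) xs)
  down-first : ∀ y → sum (map (pathWeight b y ∘ (D ∷_)) xs) ≡ below (W b m) y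
  down-first zero    = sum-zeros xs
  down-first (suc y) = refl

module Congruence {p : ℕ} .{{_ : NonZero p}} where

  infix 4 _≡ₚ_
  _≡ₚ_ : ℕ → ℕ → Set
  a ≡ₚ b = a % p ≡ b % p

  +-cong : ∀ {a a′ c c′} → a ≡ₚ a′ → c ≡ₚ c′ → a + c ≡ₚ a′ + c′
  +-cong {a} {a′} {c} {c′} a≡a′ c≡c′ = begin
    (a + c) % p             ≡⟨ %-distribˡ-+ a c p ⟩
    (a % p + c % p) % p     ≡⟨ cong₂ (λ x z → (x + z) % p) a≡a′ c≡c′ ⟩
    (a′ % p + c′ % p) % p   ≡⟨ %-distribˡ-+ a′ c′ p ⟨
    (a′ + c′) % p           ∎

  *-congˡ : ∀ c {a a′} → a ≡ₚ a′ → c * a ≡ₚ c * a′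
  *-congˡ c {a} {a′} a≡a′ = begin
    (c * a) % p               ≡⟨ %-distribˡ-* c a p ⟩
    (c % p * (a % p)) % p     ≡⟨ cong (λ x → (c % p * x) % p) a≡a′ ⟩
    (c % p * (a′ % p)) % p    ≡⟨ %-distribˡ-* c a′ p ⟨
    (c * a′) % p              ∎

  *-congˡ-∣ : ∀ {c} → p ∣ c → ∀ a a′ → c * a ≡ₚ c * a′
  *-congˡ-∣ {c} p∣c a a′ =
    trans (n∣m⇒m%n≡0 _ p (∣m⇒∣m*n a p∣c)) (sym (n∣m⇒m%n≡0 _ p (∣m⇒∣m*n a′ p∣c)))

  -- Additive cancellation: adding (p-1)·c to both sides turns c into c·p ≡ 0.
  +-cancelʳ : ∀ a b c → a + c ≡ₚ b + c → a ≡ₚ b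
  +-cancelʳ a b c a+c≡b+c = begin
    a % p                    ≡⟨ [m+kn]%n≡m%n a c p ⟨
    (a + c * p) % p          ≡⟨ cong (_% p) (absorb a) ⟨
    (a + c + pred p * c) % p ≡⟨ +-cong a+c≡b+c refl ⟩
    (b + c + pred p * c) % p ≡⟨ cong (_% p) (absorb b) ⟩
    (b + c * p) % p          ≡⟨ [m+kn]%n≡m%n b c p ⟩
    b % p                    ∎
    where
    absorb : ∀ x → x + c + pred p * c ≡ x + c * p
    absorb x = trans (+-assoc x c _)
                     (cong (x +_) (trans (cong (_* c) (suc-pred p)) (*-comm p c)))

  +-cancelˡ : ∀ c a b → c + a ≡ₚ c + b → a ≡ₚ b
  +-cancelˡ c a b c+a≡c+b = +-cancelʳ a b c
    (trans (cong (_% p) (+-comm a c)) (trans c+a≡c+b (cong (_% p) (+-comm c b))))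

  ∣∸ : ∀ {a b} → a ≤ b → a ≡ₚ b → p ∣ b ∸ a
  ∣∸ {a} {b} a≤b a≡b = m%n≡0⇒n∣m (b ∸ a) p
    (trans (sym (+-cancelˡ a 0 (b ∸ a) a+0≡a+[b∸a])) (m*n%n≡0 0 p))
    where
    a+0≡a+[b∸a] : a + 0 ≡ₚ a + (b ∸ a)
    a+0≡a+[b∸a] = subst₂ (λ x z → x ≡ₚ z) (sym (+-identityʳ a))
                          (sym (m+[n∸m]≡n a≤b)) a≡b

  ∣-distance : ∀ {a b} → a ≡ₚ b → p ∣ ∣ a - b ∣
  ∣-distance {a} {b} a≡b with ≤-total a b
  ... | inj₁ a≤b = subst (p ∣_) (sym (m≤n⇒∣m-n∣≡n∸m a≤b)) (∣∸ a≤b a≡b)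
  ... | inj₂ b≤a = subst (p ∣_) (trans (sym (m≤n⇒∣m-n∣≡n∸m b≤a)) (∣-∣-comm b a))
                         (∣∸ b≤a (sym a≡b))

  ∣-small : ∀ {d} → p ∣ d → d < p → d ≡ 0
  ∣-small {d} p∣d d<p = trans (sym (m<n⇒m%n≡m d<p)) (n∣m⇒m%n≡0 d p p∣d)

  *-cancelˡ : Prime p → ∀ {c a b} → ¬ p ∣ c → c * a ≡ₚ c * b → a ≡ₚ b
  *-cancelˡ p-prime {c} {a} {b} p∤c ca≡cb =
    ∣m-n∣≡0⇒m≡n (∣-small p∣distance
      (≤-<-trans (∣m-n∣≤m⊔n (a % p) (b % p)) (⊔-lub (m%n<n a p) (m%n<n b p))))
    where
    reduced : c * (a % p) ≡ₚ c * (b % p)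
    reduced = trans (*-congˡ c (m%n%n≡m%n a p))
                    (trans ca≡cb (*-congˡ c (sym (m%n%n≡m%n b p))))
    p∣c*distance : p ∣ c * ∣ a % p - b % p ∣
    p∣c*distance = subst (p ∣_) (sym (*-distribˡ-∣-∣ c (a % p) (b % p)))
                         (∣-distance reduced)
    p∣distance : p ∣ ∣ a % p - b % p ∣
    p∣distance = [ (λ p∣c → contradiction p∣c p∤c) , id ]′
                   (euclidsLemma c _ p-prime p∣c*distance)

  mod-injective : ∀ {a b} → a mod p ≡ b mod p → a ≡ₚ b
  mod-injective a≡b = trans (sym (toℕ-fromℕ< _)) (trans (cong toℕ a≡b) (toℕ-fromℕ< _))

-- Here s is a
-- sequence in A, compared by a relation ≈, such that "s i ≈ s j" is preserved
-- and reflected by advancing both indices (as for orbits of an injective map).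
module Orbit {A : Set} (_≈_ : A → A → Set) (s : ℕ → A)
  (forward  : ∀ i j → s i ≈ s j → s (suc i) ≈ s (suc j))
  (backward : ∀ i j → s (suc i) ≈ s (suc j) → s i ≈ s j) where

  rewind : ∀ i d → s i ≈ s (i + d) → s 0 ≈ s d
  rewind zero    d e = e
  rewind (suc i) d e = rewind i d (backward i (i + d) e)

  replay : ∀ d → s 0 ≈ s d → ∀ n → s n ≈ s (n + d)
  replay d e zero    = e
  replay d e (suc n) = forward n (n + d) (replay d e n)

  periodic-from-repeat : ∀ {i j} → i < j → s i ≈ s j →
    Σ ℕ (λ T → (0 < T) × (∀ n → s n ≈ s (n + T)))
  periodic-from-repeat {i} {j} i<j sᵢ≈sⱼ = j ∸ i , m<n⇒0<n∸m i<j ,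
    replay (j ∸ i) (rewind i (j ∸ i)
      (subst (λ k → s i ≈ s k) (sym (m+[n∸m]≡n (<⇒≤ i<j))) sᵢ≈sⱼ))

  -- If A maps injectively (up to ≈) into a finite set, then by pigeonhole
  -- some value repeats among s 0, …, s N.
  purelyPeriodic : ∀ {N} (code : A → Fin N) → (∀ {x y} → code x ≡ code y → x ≈ y) →
    Σ ℕ (λ T → (0 < T) × (∀ n → s n ≈ s (n + T)))
  purelyPeriodic {N} code code-inj
    with i , j , i<j , same-code ← pigeonhole (n<1+n N) (code ∘ s ∘ toℕ)
    = periodic-from-repeat i<j (code-inj same-code)

even-or-odd : ∀ y → ∃[ k ] (y ≡ k + k ⊎ y ≡ suc (k + k))
even-or-odd zero = 0 , inj₁ refl
even-or-odd (suc y) with even-or-odd y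
... | k , inj₁ y≡2k  = k , inj₂ (cong suc y≡2k)
... | k , inj₂ y≡2k+1 = suc k , inj₁ (trans (cong suc y≡2k+1) (cong suc (sym (+-suc k k))))

half-≤ : ∀ {k t} → k + k ≤ suc (t + t) → k ≤ t
half-≤ {zero}          _             = z≤n
half-≤ {suc k} {zero}  (s≤s k+1+k≤0) = contradiction (≤-trans (m≤n+m (suc k) k) k+1+k≤0) λ ()
half-≤ {suc k} {suc t} (s≤s bound)   =
  s≤s (half-≤ (s≤s⁻¹ (subst₂ _≤_ (+-suc k k) (cong suc (+-suc t t)) bound)))

module ReversibleTransfer {p : ℕ} .{{_ : NonZero p}} (p-prime : Prime p)
  (b : ℕ → ℕ) (t : ℕ)
  (b-unit : ∀ y → y < suc (t + t) → ¬ p ∣ b y)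
  (b-top  : p ∣ b (suc (t + t))) where

  open Congruence {p}

  h : ℕ
  h = suc (t + t)

  _≈_ : (ℕ → ℕ) → (ℕ → ℕ) → Set
  v ≈ w = ∀ y → y ≤ h → v y ≡ₚ w y

  -- The transfer respects ≈, because the height h+1 is only seen through b h.
  transfer-cong : ∀ {v w} → v ≈ w → transfer b v ≈ transfer b w
  transfer-cong {v} {w} v≈w y y≤h = +-cong up-term (down-term y y≤h)
    where
    up-term : b y * v (suc y) ≡ₚ b y * w (suc y)
    up-term with m≤n⇒m<n∨m≡n y≤h
    ... | inj₁ y<h  = *-congˡ (b y) (v≈w (suc y) y<h)
    ... | inj₂ refl = *-congˡ-∣ b-top (v (suc h)) (w (suc h))
    down-term : ∀ y → y ≤ h → below v y ≡ₚ below w y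
    down-term zero    _   = refl
    down-term (suc y) y<h = v≈w y (<⇒≤ y<h)

  transfer-inj : ∀ {v w} → transfer b v ≈ transfer b w → v ≈ w
  transfer-inj {v} {w} Tv≈Tw = agree-everywhere
    where
    Agree : ℕ → Set
    Agree y = v y ≡ₚ w y

    solve-up : ∀ y → y < h → below v y ≡ₚ below w y → Agree (suc y)
    solve-up y y<h below-agree = *-cancelˡ p-prime (b-unit y y<h)
      (+-cancelʳ _ _ (below w y)
        (trans (+-cong {b y * v (suc y)} refl (sym below-agree)) (Tv≈Tw y (<⇒≤ y<h))))

    solve-down : ∀ y → y ≤ h → b y * v (suc y) ≡ₚ b y * w (suc y) →
                 below v y ≡ₚ below w y
    solve-down y y≤h up-agree = +-cancelˡ (b y * w (suc y)) _ _
      (trans (+-cong (sym up-agree) refl) (Tv≈Tw y y≤h))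

    -- Odd heights, bottom-up from the equation at 0 (nothing below ground).
    agree-odd : ∀ k → k ≤ t → Agree (suc (k + k))
    agree-odd zero    _   = solve-up 0 (s≤s z≤n) refl
    agree-odd (suc k) k<t =
      subst (Agree ∘ suc ∘ suc) (sym (+-suc k k))
        (solve-up (suc (suc (k + k))) (s≤s 2k+2≤2t) (agree-odd k (<⇒≤ k<t)))
      where
      2k+2≤2t : suc (suc (k + k)) ≤ t + t
      2k+2≤2t = subst (_≤ t + t) (+-suc (suc k) k) (+-mono-≤ k<t k<t)

    -- Even heights, top-down from the equation at h, where b h ≡ 0.
    agree-even : ∀ j k → k + j ≡ t → Agree (k + k)
    agree-even zero    k k+0≡t =
      subst (λ i → Agree (i + i)) (sym (trans (sym (+-identityʳ k)) k+0≡t))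
        (solve-down h ≤-refl (*-congˡ-∣ b-top _ _))
    agree-even (suc j) k k+j+1≡t =
      solve-down (suc (k + k)) (s≤s (+-mono-≤ k≤t k≤t))
        (*-congˡ (b (suc (k + k)))
          (subst (Agree ∘ suc) (+-suc k k)
            (agree-even j (suc k) (trans (sym (+-suc k j)) k+j+1≡t))))
      where
      k≤t : k ≤ t
      k≤t = subst (k ≤_) k+j+1≡t (m≤m+n k (suc j))

    agree-everywhere : v ≈ w
    agree-everywhere y y≤h with even-or-odd y
    ... | k , inj₁ refl = agree-even (t ∸ k) k (m+[n∸m]≡n (half-≤ {k} y≤h))
    ... | k , inj₂ refl = agree-odd k (half-≤ (<⇒≤ y≤h))

  residues : (ℕ → ℕ) → Fin (suc h) → Fin p
  residues v i = v (toℕ i) mod p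

  code : (ℕ → ℕ) → Fin (p ^ suc h)
  code v = funToFin (residues v)

  code-inj : ∀ {v w} → code v ≡ code w → v ≈ w
  code-inj {v} {w} same-code y y≤h =
    subst (λ z → v z ≡ₚ w z) (toℕ-fromℕ< (s≤s y≤h))
      (mod-injective (begin
        v (toℕ i) mod p          ≡⟨ finToFun-funToFin (residues v) i ⟨
        finToFun (code v) i      ≡⟨ cong (λ c → finToFun c i) same-code ⟩
        finToFun (code w) i      ≡⟨ finToFun-funToFin (residues w) i ⟩
        w (toℕ i) mod p          ∎))
    where
    i : Fin (suc h)
    i = fromℕ< (s≤s y≤h)

  W-periodic : Σ ℕ (λ T → (0 < T) × (∀ m → W b m ≈ W b (m + T)))
  W-periodic = Orbit.purelyPeriodic _≈_ (W b) forward backward code code-inj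
    where
    forward : ∀ i j → W b i ≈ W b j → W b (suc i) ≈ W b (suc j)
    forward i j Wᵢ≈Wⱼ y y≤h = subst₂ (λ x z → x ≡ₚ z)
      (sym (W-suc b i y)) (sym (W-suc b j y)) (transfer-cong Wᵢ≈Wⱼ y y≤h)
    backward : ∀ i j → W b (suc i) ≈ W b (suc j) → W b i ≈ W b j
    backward i j Wᵢ₊₁≈Wⱼ₊₁ = transfer-inj λ y y≤h → subst₂ (λ x z → x ≡ₚ z)
      (W-suc b i y) (W-suc b j y) (Wᵢ₊₁≈Wⱼ₊₁ y y≤h)

  C-periodic : Σ ℕ (λ T → (0 < T) × ((n : ℕ) → C b (n + T) % p ≡ C b n % p))
  C-periodic with T , 0<T , period ← W-periodic = T , 0<T , λ n → sym (begin
    C b n % p                    ≡⟨ cong (_% p) (C≡W b n) ⟩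
    W b (2 * n) 0 % p            ≡⟨ period (2 * n) 0 z≤n ⟩
    W b (2 * n + T) 0 % p        ≡⟨ period (2 * n + T) 0 z≤n ⟩
    W b (2 * n + T + T) 0 % p    ≡⟨ cong (λ m → W b m 0 % p) (double-+ n T) ⟨
    W b (2 * (n + T)) 0 % p      ≡⟨ cong (_% p) (C≡W b (n + T)) ⟨
    C b (n + T) % p              ∎)
    where
    double-+ : ∀ n T → 2 * (n + T) ≡ 2 * n + T + T
    double-+ = solve-∀

bL-top : ∀ {p h} → 2 * h + 1 ≡ p → p ∣ bL h
bL-top refl = m∣m*n _

-- Below h, 0 < 2y+1 < p, so the prime p does not divide (2y+1)².
bL-unit : ∀ {p h} → Prime p → 2 * h + 1 ≡ p → ∀ y → y < h → ¬ p ∣ bL y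
bL-unit {p} p-prime refl y y<h p∣bL = <⇒≱ 2y+1<p (∣⇒≤ {{>-nonZero 0<2y+1}} p∣2y+1)
  where
  0<2y+1 : 0 < 2 * y + 1
  0<2y+1 = m≤n+m 1 (2 * y)
  2y+1<p : 2 * y + 1 < p
  2y+1<p = +-monoˡ-< 1 (*-monoʳ-< 2 y<h)
  p∣2y+1 : p ∣ 2 * y + 1
  p∣2y+1 = reduce (euclidsLemma (2 * y + 1) (2 * y + 1) p-prime p∣bL)

-- p ≡ 3 (mod 4) means p = 2h+1 with h = 2t+1 odd, where t = p / 4.
p≡3mod4⇒odd-half : ∀ p → p % 4 ≡ 3 → 2 * suc (p / 4 + p / 4) + 1 ≡ p
p≡3mod4⇒odd-half p p%4≡3 = begin
  2 * suc (p / 4 + p / 4) + 1   ≡⟨ rearrange (p / 4) ⟩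
  3 + p / 4 * 4                 ≡⟨ cong (_+ p / 4 * 4) p%4≡3 ⟨
  p % 4 + p / 4 * 4             ≡⟨ m≡m%n+[m/n]*n p 4 ⟨
  p                             ∎
  where
  rearrange : ∀ t → 2 * suc (t + t) + 1 ≡ 3 + t * 4
  rearrange = solve-∀

corollary4p6 : (p : ℕ) → .{{_ : NonZero p}} → Prime p → p % 4 ≡ 3 →
    Σ ℕ (λ T → (0 < T) × ((n : ℕ) → L (n + T) % p ≡ L n % p))
corollary4p6 p p-prime p%4≡3 = C-periodic
  where
  t : ℕ
  t = p / 4
  p≡2h+1 : 2 * suc (t + t) + 1 ≡ p
  p≡2h+1 = p≡3mod4⇒odd-half p p%4≡3
  open ReversibleTransfer p-prime bL t
         (bL-unit {h = suc (t + t)} p-prime p≡2h+1) (bL-top {h = suc (t + t)} p≡2h+1)
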